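{- Let $f:\{ -1,1\}^n\to\{ -1,1\}$ and let $g:\{ -1,1\}^n\to\{ -1,1\}$ be a $k$-junta on the variables $\{1,\dots,k\}$ (i.e. $g(x)$ depends only on $x_1,\dots,x_k$) such that $\mathbf{E}[f g]\ge c$. Then for any $\tau>0$ there is a set $S\subseteq[k]$ such that (1) for every $i\in S$, $\mathsf{Inf}_i^{\le k}(f)\ge \tau^2/k^2$; and (2) there is a function $h:\{ -1,1\}^n\to\{ -1,1\}$ depending only on the variables in $S$ with $\mathbf{E}[f h]\ge c-\tau$.
   Context: Expectations are over the uniform distribution on $\{ -1,1\}^n$. For $f=\sum_S\widehat f(S)\chi_S$ (Fourier expansion, $\chi_S(x)=\prod_{i\in S}x_i$), $\mathsf{Inf}_i^{\le k}(f)=\sum_{S\ni i,\,|S|\le k}\widehat f(S)^2$.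
   Formalization: The parameters c and τ range over the rationals. -}

module Defs where

open import Data.Bool using (Bool; true; false; _∧_; T?; if_then_else_)
open import Data.Nat as ℕ using (ℕ; zero; suc)
open import Data.Fin using (Fin)
open import Data.Fin.Subset using (Subset; _∈_; ∣_∣)
open import Data.Vec using (Vec; []; _∷_; lookup)
open import Data.List using (List; []; _∷_; _++_; map; foldr; filter; allFin)
open import Data.Rational using (ℚ; 0ℚ; 1ℚ; ½; _+_; _*_; -_; _≤_; _<_; ↥_; ↧_)
open import Data.Integer using (+_)
open import Relation.Binary.PropositionalEquality using (_≡_)
open import Relation.Nullary using (Dec; yes; no)

-- The cube {-1,1}^n: points are Vec Bool n, with true ↦ +1, false ↦ -1.
Cube : ℕ → Set
Cube n = Vec Bool n

BoolFun : ℕ → Set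
BoolFun n = Cube n → Bool

sgn : Bool → ℚ
sgn true  = 1ℚ
sgn false = - 1ℚ

-- enumeration of all 2^n points of the cube (also all subsets of [n])
allVecs : (n : ℕ) → List (Vec Bool n)
allVecs zero    = [] ∷ []
allVecs (suc n) = map (true ∷_) (allVecs n) ++ map (false ∷_) (allVecs n)

sumℚ : List ℚ → ℚ
sumℚ = foldr _+_ 0ℚ

prodℚ : List ℚ → ℚ
prodℚ = foldr _*_ 1ℚ

halfPow : ℕ → ℚ
halfPow zero    = 1ℚ
halfPow (suc n) = ½ * halfPow n

E : {n : ℕ} → (Cube n → ℚ) → ℚ
E {n} F = sumℚ (map F (allVecs n)) * halfPow n

χ : {n : ℕ} → Subset n → Cube n → ℚ
χ {n} S x = prodℚ (map (λ i → if lookup S i then sgn (lookup x i) else 1ℚ) (allFin n))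

fourier : {n : ℕ} → BoolFun n → Subset n → ℚ
fourier f S = E (λ x → sgn (f x) * χ S x)

Inf≤ : {n : ℕ} → ℕ → BoolFun n → Fin n → ℚ
Inf≤ {n} k f i =
  sumℚ (map (λ S → fourier f S * fourier f S)
            (filter (λ S → T? (lookup S i ∧ (∣ S ∣ ℕ.≤ᵇ k))) (allVecs n)))

DependsOnly : {n : ℕ} → (Fin n → Set) → BoolFun n → Set
DependsOnly {n} P h = (x y : Cube n) → ((i : Fin n) → P i → lookup x i ≡ lookup y i) → h x ≡ h y

-- Let S be the coordinates i < k with k² Inf_i^{≤k}(f) ≥ τ², and h the sign of the
-- conditional expectation E[f | x_S]. Since ĝ vanishes off subsets of [k], Plancherel
-- splits E[fg] into E[E[f | x_S] E[g | x_S]], which is at most E[E[f | x_S] h] = E[fh]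
-- because |E[g | x_S]| ≤ 1, plus the sum of f̂(T) ĝ(T) over T ⊆ [k] with T ⊈ S. Such a
-- T has |T| ≤ k and meets [k] ∖ S, so these f̂(T)² add up to at most k · τ²/k² ≤ τ²;
-- as ∑ ĝ(T)² = 1, Cauchy–Schwarz bounds that sum by τ.

module Submission where

open import Defs
open import Data.Nat using (ℕ; _≤_)
open import Data.Nat as ℕ using ()
open import Data.Fin using (Fin; toℕ)
open import Data.Fin.Subset using (Subset; _∈_)
open import Data.Rational using (ℚ; _+_; _*_; _-_; _<_; 0ℚ)
open import Data.Rational as ℚ using ()
open import Data.Integer using (+_)
open import Data.Product using (Σ; _×_)

open import Data.Bool using (Bool; true; false; _∧_; not; T?; if_then_else_)
open import Data.Bool.Properties using (T-≡)
open import Data.Empty using (⊥-elim)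
open import Data.Fin using (zero; suc)
open import Data.Fin.Subset using (∣_∣; ⊥)
open import Data.Fin.Subset.Properties using (_⊆?_; p⊆q⇒∣p∣≤∣q∣; ∉⊥)
import Data.Integer.Properties as ℤ
open import Data.List using (List; []; _∷_; _++_; map; filter; allFin)
open import Data.List.Membership.Propositional using () renaming (_∈_ to _∈ₗ_)
open import Data.List.Membership.Propositional.Properties using (∈-allFin)
import Data.List.Properties as List
open import Data.List.Relation.Unary.Any using (here; there)
open import Data.Nat using (zero; suc)
open import Data.Nat.Coprimality using (Coprime)
open import Data.Nat.Divisibility using (∣1⇒≡1)
import Data.Nat.Properties as ℕₚ
open import Data.Product using (_,_; ∃; proj₁; proj₂)
import Data.Product as Product
open import Data.Rational using (1ℚ; ½; -_)
import Data.Rational.Properties as ℚ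
open import Data.Rational.Solver using (module +-*-Solver)
open +-*-Solver
open import Data.Sum using (inj₁; inj₂)
open import Data.Vec using (_∷_; []; lookup; tabulate)
import Data.Vec.Properties as Vecₚ
open import Function using (_∘_; id)
open import Function.Bundles using (Equivalence)
open import Relation.Binary.PropositionalEquality
open import Relation.Nullary using (Dec; yes; no; does)

0≤p*q : ∀ {p q} → 0ℚ ℚ.≤ p → 0ℚ ℚ.≤ q → 0ℚ ℚ.≤ p * q
0≤p*q {p} {q} 0≤p 0≤q =
  ℚ.nonNegative⁻¹ (p * q) {{ℚ.nonNeg*nonNeg⇒nonNeg p {{ℚ.nonNegative 0≤p}} q {{ℚ.nonNegative 0≤q}}}}

0≤p+q : ∀ {p q} → 0ℚ ℚ.≤ p → 0ℚ ℚ.≤ q → 0ℚ ℚ.≤ p + q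
0≤p+q = ℚ.+-mono-≤

0≤p*p : ∀ p → 0ℚ ℚ.≤ p * p
0≤p*p p with ℚ.≤-total 0ℚ p
... | inj₁ 0≤p = 0≤p*q 0≤p 0≤p
... | inj₂ p≤0 = subst (0ℚ ℚ.≤_) (solve 1 (λ p → (:- p) :* (:- p) := p :* p) refl p) (0≤p*q 0≤-p 0≤-p)
  where 0≤-p = ℚ.neg-antimono-≤ p≤0

0≤q-p⇒p≤q : ∀ {p q} → 0ℚ ℚ.≤ q - p → p ℚ.≤ q
0≤q-p⇒p≤q {p} {q} 0≤q-p = subst₂ ℚ._≤_ (ℚ.+-identityˡ p)
  (solve 2 (λ p q → (q :- p) :+ p := q) refl p q) (ℚ.+-monoˡ-≤ p 0≤q-p)

p≤p+q : ∀ p {q} → 0ℚ ℚ.≤ q → p ℚ.≤ p + q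
p≤p+q p {q} 0≤q = subst (ℚ._≤ p + q) (ℚ.+-identityʳ p) (ℚ.+-monoʳ-≤ p 0≤q)

p≤q+p : ∀ p {q} → 0ℚ ℚ.≤ q → p ℚ.≤ q + p
p≤q+p p {q} 0≤q = subst (ℚ._≤ q + p) (ℚ.+-identityˡ p) (ℚ.+-monoˡ-≤ p 0≤q)

≤+⇒-≤ : ∀ {p q r} → p ℚ.≤ q + r → p - r ℚ.≤ q
≤+⇒-≤ {p} {q} {r} p≤q+r = ℚ.≤-trans (ℚ.+-monoˡ-≤ (- r) p≤q+r)
  (ℚ.≤-reflexive (solve 2 (λ q r → q :+ r :- r := q) refl q r))

𝟙 : Bool → ℚ
𝟙 true  = 1ℚ
𝟙 false = 0ℚ

0≤𝟙 : ∀ b → 0ℚ ℚ.≤ 𝟙 b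
0≤𝟙 true  = ℚ.≤ᵇ⇒≤ _
0≤𝟙 false = ℚ.≤-refl

𝟙-idem : ∀ b p → 𝟙 b * p * (𝟙 b * p) ≡ 𝟙 b * (p * p)
𝟙-idem true  p = solve 1 (λ p → con 1ℚ :* p :* (con 1ℚ :* p) := con 1ℚ :* (p :* p)) refl p
𝟙-idem false p = solve 1 (λ p → con 0ℚ :* p :* (con 0ℚ :* p) := con 0ℚ :* (p :* p)) refl p

sgn-sq : ∀ b → sgn b * sgn b ≡ 1ℚ
sgn-sq true  = refl
sgn-sq false = refl

toℚ : ℕ → ℚ
toℚ m = + m ℚ./ 1

coprime-1 : ∀ m → Coprime m 1
coprime-1 m (_ , d∣1) = ∣1⇒≡1 d∣1

toℚ≡mkℚ : ∀ m → toℚ m ≡ ℚ.mkℚ (+ m) 0 (coprime-1 m)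
toℚ≡mkℚ m = ℚ.↥p/↧p≡p (ℚ.mkℚ (+ m) 0 (coprime-1 m))

toℚ-suc : ∀ m → toℚ (suc m) ≡ 1ℚ + toℚ m
toℚ-suc m rewrite toℚ≡mkℚ m | ℤ.*-identityʳ (+ m) = refl

0≤toℚ : ∀ m → 0ℚ ℚ.≤ toℚ m
0≤toℚ zero    = ℚ.≤-refl
0≤toℚ (suc m) = subst (0ℚ ℚ.≤_) (sym (toℚ-suc m)) (0≤p+q {1ℚ} (ℚ.≤ᵇ⇒≤ _) (0≤toℚ m))

toℚ-suc-pos : ∀ m → ℚ.Positive (toℚ (suc m))
toℚ-suc-pos m = subst ℚ.Positive (sym (toℚ-suc m)) (ℚ.pos+nonNeg⇒pos 1ℚ (toℚ m) {{ℚ.nonNegative (0≤toℚ m)}})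

toℚ-mono : ∀ {m n} → m ≤ n → toℚ m ℚ.≤ toℚ n
toℚ-mono {n = n} ℕ.z≤n = 0≤toℚ n
toℚ-mono {suc m} {suc n} (ℕ.s≤s m≤n) =
  subst₂ ℚ._≤_ (sym (toℚ-suc m)) (sym (toℚ-suc n)) (ℚ.+-monoʳ-≤ 1ℚ (toℚ-mono {m} {n} m≤n))

∑ : {A : Set} → List A → (A → ℚ) → ℚ
∑ xs φ = sumℚ (map φ xs)

module _ {A : Set} where

  ∑-cong : ∀ xs {φ ψ : A → ℚ} → (∀ a → φ a ≡ ψ a) → ∑ xs φ ≡ ∑ xs ψ
  ∑-cong []       φ≡ψ = refl
  ∑-cong (x ∷ xs) φ≡ψ = cong₂ _+_ (φ≡ψ x) (∑-cong xs φ≡ψ)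

  ∑-++ : ∀ xs ys (φ : A → ℚ) → ∑ (xs ++ ys) φ ≡ ∑ xs φ + ∑ ys φ
  ∑-++ []       ys φ = sym (ℚ.+-identityˡ _)
  ∑-++ (x ∷ xs) ys φ = trans (cong (_+_ (φ x)) (∑-++ xs ys φ)) (sym (ℚ.+-assoc (φ x) _ _))

  ∑-+ : ∀ xs (φ ψ : A → ℚ) → ∑ xs (λ a → φ a + ψ a) ≡ ∑ xs φ + ∑ xs ψ
  ∑-+ []       φ ψ = refl
  ∑-+ (x ∷ xs) φ ψ rewrite ∑-+ xs φ ψ =
    solve 4 (λ a b c d → (a :+ b) :+ (c :+ d) := (a :+ c) :+ (b :+ d)) refl (φ x) (ψ x) (∑ xs φ) (∑ xs ψ)

  ∑-* : ∀ xs c (φ : A → ℚ) → ∑ xs (λ a → c * φ a) ≡ c * ∑ xs φ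
  ∑-* []       c φ = sym (ℚ.*-zeroʳ c)
  ∑-* (x ∷ xs) c φ rewrite ∑-* xs c φ = sym (ℚ.*-distribˡ-+ c (φ x) (∑ xs φ))

  ∑-zero : ∀ xs → ∑ {A} xs (λ _ → 0ℚ) ≡ 0ℚ
  ∑-zero []       = refl
  ∑-zero (x ∷ xs) rewrite ∑-zero xs = refl

  ∑-mono : ∀ xs {φ ψ : A → ℚ} → (∀ a → φ a ℚ.≤ ψ a) → ∑ xs φ ℚ.≤ ∑ xs ψ
  ∑-mono []       φ≤ψ = ℚ.≤-refl
  ∑-mono (x ∷ xs) φ≤ψ = ℚ.+-mono-≤ (φ≤ψ x) (∑-mono xs φ≤ψ)

  ∑-nonneg : ∀ xs {φ : A → ℚ} → (∀ a → 0ℚ ℚ.≤ φ a) → 0ℚ ℚ.≤ ∑ xs φ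
  ∑-nonneg []       0≤φ = ℚ.≤-refl
  ∑-nonneg (x ∷ xs) 0≤φ = 0≤p+q (0≤φ x) (∑-nonneg xs 0≤φ)

  term≤∑ : ∀ xs {φ : A → ℚ} → (∀ a → 0ℚ ℚ.≤ φ a) → ∀ {x} → x ∈ₗ xs → φ x ℚ.≤ ∑ xs φ
  term≤∑ (y ∷ xs) {φ} 0≤φ (here refl)    = p≤p+q (φ y) (∑-nonneg xs 0≤φ)
  term≤∑ (y ∷ xs) {φ} 0≤φ (there x∈xs) = ℚ.≤-trans (term≤∑ xs 0≤φ x∈xs) (p≤q+p (∑ xs φ) (0≤φ y))

  ∑-filter : ∀ xs (P : A → Bool) (φ : A → ℚ) →
             ∑ (filter (T? ∘ P) xs) φ ≡ ∑ xs (λ a → 𝟙 (P a) * φ a)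
  ∑-filter []       P φ = refl
  ∑-filter (x ∷ xs) P φ with P x
  ... | true  = cong₂ _+_ (sym (ℚ.*-identityˡ (φ x))) (∑-filter xs P φ)
  ... | false = trans (∑-filter xs P φ) (sym (trans (cong (_+ _) (ℚ.*-zeroˡ (φ x))) (ℚ.+-identityˡ _)))

∑-map : {A B : Set} (xs : List A) (g : A → B) (φ : B → ℚ) → ∑ (map g xs) φ ≡ ∑ xs (φ ∘ g)
∑-map []       g φ = refl
∑-map (x ∷ xs) g φ = cong (_+_ (φ (g x))) (∑-map xs g φ)

∑-comm : {A B : Set} (xs : List A) (ys : List B) (φ : A → B → ℚ) →
         ∑ xs (λ a → ∑ ys (φ a)) ≡ ∑ ys (λ b → ∑ xs (λ a → φ a b))
∑-comm []       ys φ = sym (∑-zero ys)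
∑-comm (x ∷ xs) ys φ rewrite ∑-comm xs ys φ = sym (∑-+ ys (φ x) _)

∑-allFin-suc : ∀ n (φ : Fin (suc n) → ℚ) → ∑ (allFin (suc n)) φ ≡ φ zero + ∑ (allFin n) (φ ∘ suc)
∑-allFin-suc n φ = cong (λ xs → φ zero + sumℚ xs)
  (trans (List.map-tabulate suc φ) (sym (List.map-tabulate id (φ ∘ suc))))

∑-𝟙-lookup : ∀ {n} (P : Subset n) → ∑ (allFin n) (𝟙 ∘ lookup P) ≡ toℚ ∣ P ∣
∑-𝟙-lookup []            = refl
∑-𝟙-lookup (true  ∷ P) = trans (∑-allFin-suc _ (𝟙 ∘ lookup (true ∷ P)))
                                (trans (cong (_+_ 1ℚ) (∑-𝟙-lookup P)) (sym (toℚ-suc ∣ P ∣)))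
∑-𝟙-lookup (false ∷ P) = trans (∑-allFin-suc _ (𝟙 ∘ lookup (false ∷ P)))
                                (trans (ℚ.+-identityˡ _) (∑-𝟙-lookup P))

0≤halfPow : ∀ n → 0ℚ ℚ.≤ halfPow n
0≤halfPow zero    = ℚ.≤ᵇ⇒≤ _
0≤halfPow (suc n) = 0≤p*q {½} (ℚ.≤ᵇ⇒≤ _) (0≤halfPow n)

module _ {n : ℕ} where

  E-cong : {F G : Cube n → ℚ} → (∀ x → F x ≡ G x) → E F ≡ E G
  E-cong F≡G = cong (_* halfPow n) (∑-cong (allVecs n) F≡G)

  E-+ : (F G : Cube n → ℚ) → E (λ x → F x + G x) ≡ E F + E G
  E-+ F G rewrite ∑-+ (allVecs n) F G = ℚ.*-distribʳ-+ (halfPow n) (∑ (allVecs n) F) (∑ (allVecs n) G)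

  E-* : (c : ℚ) (F : Cube n → ℚ) → E (λ x → c * F x) ≡ c * E F
  E-* c F rewrite ∑-* (allVecs n) c F = ℚ.*-assoc c (∑ (allVecs n) F) (halfPow n)

  E-mono : {F G : Cube n → ℚ} → (∀ x → F x ℚ.≤ G x) → E F ℚ.≤ E G
  E-mono F≤G = ℚ.*-monoʳ-≤-nonNeg (halfPow n) {{ℚ.nonNegative (0≤halfPow n)}} (∑-mono (allVecs n) F≤G)

∑-allVecs-suc : ∀ n (φ : Cube (suc n) → ℚ) →
                ∑ (allVecs (suc n)) φ ≡ ∑ (allVecs n) (φ ∘ (true ∷_)) + ∑ (allVecs n) (φ ∘ (false ∷_))
∑-allVecs-suc n φ = trans (∑-++ (map (true ∷_) xs) (map (false ∷_) xs) φ)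
                          (cong₂ _+_ (∑-map xs (true ∷_) φ) (∑-map xs (false ∷_) φ))
  where xs = allVecs n

E-∷ : ∀ {n} (F : Cube (suc n) → ℚ) → E F ≡ ½ * (E (F ∘ (true ∷_)) + E (F ∘ (false ∷_)))
E-∷ {n} F = trans (cong (_* (½ * halfPow n)) (∑-allVecs-suc n F))
  (solve 3 (λ a b h → (a :+ b) :* (con ½ :* h) := con ½ :* (a :* h :+ b :* h)) refl
     (∑ (allVecs n) (F ∘ (true ∷_))) (∑ (allVecs n) (F ∘ (false ∷_))) (halfPow n))

E-1 : ∀ n → E {n} (λ _ → 1ℚ) ≡ 1ℚ
E-1 zero    = refl
E-1 (suc n) = trans (E-∷ {n} (λ _ → 1ℚ)) (cong (λ e → ½ * (e + e)) (E-1 n))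

χ-∷ : ∀ {n} b (S : Subset n) x₀ (x : Cube n) → χ (b ∷ S) (x₀ ∷ x) ≡ (if b then sgn x₀ else 1ℚ) * χ S x
χ-∷ {n} b S x₀ x = cong ((if b then sgn x₀ else 1ℚ) *_) (cong prodℚ
  (trans (List.map-tabulate suc (λ i → if lookup (b ∷ S) i then sgn (lookup (x₀ ∷ x) i) else 1ℚ))
         (sym (List.map-tabulate id (λ i → if lookup S i then sgn (lookup x i) else 1ℚ)))))

coeff : ∀ {n} → (Cube n → ℚ) → Subset n → ℚ
coeff F T = E (λ x → F x * χ T x)

coeff-cong : ∀ {n} {F G : Cube n → ℚ} → (∀ x → F x ≡ G x) → ∀ T → coeff F T ≡ coeff G T
coeff-cong F≡G T = E-cong (λ x → cong (_* χ T x) (F≡G x))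

coeff-inside : ∀ {n} (F : Cube (suc n) → ℚ) T →
               coeff F (true ∷ T) ≡ ½ * (coeff (F ∘ (true ∷_)) T - coeff (F ∘ (false ∷_)) T)
coeff-inside {n} F T = begin
    coeff F (true ∷ T)
  ≡⟨ E-∷ (λ x → F x * χ (true ∷ T) x) ⟩
    ½ * (E (λ x → F (true ∷ x) * χ (true ∷ T) (true ∷ x))
       + E (λ x → F (false ∷ x) * χ (true ∷ T) (false ∷ x)))
  ≡⟨ cong (½ *_) (cong₂ _+_
       (E-cong (λ x → cong (F (true ∷ x) *_) (trans (χ-∷ true T true x) (ℚ.*-identityˡ _))))
       (trans (E-cong (λ x → trans (cong (F (false ∷ x) *_) (χ-∷ true T false x))
                (solve 2 (λ a b → a :* (con (- 1ℚ) :* b) := con (- 1ℚ) :* (a :* b)) refl (F (false ∷ x)) (χ T x))))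
              (E-* (- 1ℚ) (λ x → F (false ∷ x) * χ T x)))) ⟩
    ½ * (coeff (F ∘ (true ∷_)) T + - 1ℚ * coeff (F ∘ (false ∷_)) T)
  ≡⟨ solve 2 (λ a b → con ½ :* (a :+ con (- 1ℚ) :* b) := con ½ :* (a :- b)) refl
       (coeff (F ∘ (true ∷_)) T) (coeff (F ∘ (false ∷_)) T) ⟩
    ½ * (coeff (F ∘ (true ∷_)) T - coeff (F ∘ (false ∷_)) T)
  ∎
  where open ≡-Reasoning

coeff-outside : ∀ {n} (F : Cube (suc n) → ℚ) T →
                coeff F (false ∷ T) ≡ ½ * (coeff (F ∘ (true ∷_)) T + coeff (F ∘ (false ∷_)) T)
coeff-outside F T = trans (E-∷ (λ x → F x * χ (false ∷ T) x)) (cong (½ *_) (cong₂ _+_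
  (E-cong (λ x → cong (F (true ∷ x) *_) (trans (χ-∷ false T true x) (ℚ.*-identityˡ _))))
  (E-cong (λ x → cong (F (false ∷ x) *_) (trans (χ-∷ false T false x) (ℚ.*-identityˡ _))))))

avgHead : ∀ {n} → (Cube (suc n) → ℚ) → Cube n → ℚ
avgHead F x = ½ * (F (true ∷ x) + F (false ∷ x))

coeff-avgHead : ∀ {n} (F : Cube (suc n) → ℚ) T → coeff (avgHead F) T ≡ coeff F (false ∷ T)
coeff-avgHead F T = begin
    E (λ x → ½ * (F₁ x + F₀ x) * χ T x)
  ≡⟨ E-cong (λ x → solve 3 (λ a b t → con ½ :* (a :+ b) :* t := con ½ :* (a :* t) :+ con ½ :* (b :* t))
       refl (F₁ x) (F₀ x) (χ T x)) ⟩
    E (λ x → ½ * (F₁ x * χ T x) + ½ * (F₀ x * χ T x))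
  ≡⟨ E-+ (λ x → ½ * (F₁ x * χ T x)) (λ x → ½ * (F₀ x * χ T x)) ⟩
    E (λ x → ½ * (F₁ x * χ T x)) + E (λ x → ½ * (F₀ x * χ T x))
  ≡⟨ cong₂ _+_ (E-* ½ (λ x → F₁ x * χ T x)) (E-* ½ (λ x → F₀ x * χ T x)) ⟩
    ½ * coeff F₁ T + ½ * coeff F₀ T
  ≡⟨ sym (ℚ.*-distribˡ-+ ½ (coeff F₁ T) (coeff F₀ T)) ⟩
    ½ * (coeff F₁ T + coeff F₀ T)
  ≡⟨ sym (coeff-outside F T) ⟩
    coeff F (false ∷ T)
  ∎
  where open ≡-Reasoning
        F₁ = F ∘ (true ∷_)
        F₀ = F ∘ (false ∷_)

plancherel : ∀ n (F G : Cube n → ℚ) → E (λ x → F x * G x) ≡ ∑ (allVecs n) (λ T → coeff F T * coeff G T)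
plancherel zero F G = solve 2 (λ a b → (a :* b :+ con 0ℚ) :* con 1ℚ
   := ((a :* con 1ℚ :+ con 0ℚ) :* con 1ℚ) :* ((b :* con 1ℚ :+ con 0ℚ) :* con 1ℚ) :+ con 0ℚ) refl (F []) (G [])
plancherel (suc n) F G = begin
    E (λ x → F x * G x)
  ≡⟨ E-∷ (λ x → F x * G x) ⟩
    ½ * (E (λ x → F₁ x * G₁ x) + E (λ x → F₀ x * G₀ x))
  ≡⟨ cong (½ *_) (cong₂ _+_ (plancherel n F₁ G₁) (plancherel n F₀ G₀)) ⟩
    ½ * (∑ xs (λ T → a T * c T) + ∑ xs (λ T → b T * d T))
  ≡⟨ cong (½ *_) (sym (∑-+ xs _ _)) ⟩
    ½ * ∑ xs (λ T → a T * c T + b T * d T)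
  ≡⟨ sym (∑-* xs ½ _) ⟩
    ∑ xs (λ T → ½ * (a T * c T + b T * d T))
  ≡⟨ ∑-cong xs (λ T → solve 4 (λ a b c d → con ½ :* (a :* c :+ b :* d) :=
       (con ½ :* (a :- b)) :* (con ½ :* (c :- d)) :+ (con ½ :* (a :+ b)) :* (con ½ :* (c :+ d)))
       refl (a T) (b T) (c T) (d T)) ⟩
    ∑ xs (λ T → ½ * (a T - b T) * (½ * (c T - d T)) + ½ * (a T + b T) * (½ * (c T + d T)))
  ≡⟨ ∑-+ xs _ _ ⟩
    ∑ xs (λ T → ½ * (a T - b T) * (½ * (c T - d T))) + ∑ xs (λ T → ½ * (a T + b T) * (½ * (c T + d T)))
  ≡⟨ sym (cong₂ _+_ (∑-cong xs (λ T → cong₂ _*_ (coeff-inside F T) (coeff-inside G T)))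
                    (∑-cong xs (λ T → cong₂ _*_ (coeff-outside F T) (coeff-outside G T)))) ⟩
    ∑ xs (FG ∘ (true ∷_)) + ∑ xs (FG ∘ (false ∷_))
  ≡⟨ sym (∑-allVecs-suc n FG) ⟩
    ∑ (allVecs (suc n)) FG
  ∎
  where
  open ≡-Reasoning
  xs = allVecs n
  F₁ F₀ G₁ G₀ : Cube n → ℚ
  F₁ = F ∘ (true ∷_)
  F₀ = F ∘ (false ∷_)
  G₁ = G ∘ (true ∷_)
  G₀ = G ∘ (false ∷_)
  a b c d : Subset n → ℚ
  a = coeff F₁
  b = coeff F₀
  c = coeff G₁
  d = coeff G₀
  FG : Subset (suc n) → ℚ
  FG T = coeff F T * coeff G T

_⊆ᵇ_ : ∀ {n} → Subset n → Subset n → Bool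
T ⊆ᵇ S = does (T ⊆? S)

_≈[_]_ : ∀ {n} → Cube n → Subset n → Cube n → Set
x ≈[ S ] y = ∀ i → lookup S i ≡ true → lookup x i ≡ lookup y i

Junta : ∀ {n} → Subset n → (Cube n → ℚ) → Set
Junta S F = ∀ x y → x ≈[ S ] y → F x ≡ F y

-- condE S F x averages F over the coordinates outside S, keeping those of x in S:
-- the conditional expectation E[F | x_S].
condE : ∀ {n} → Subset n → (Cube n → ℚ) → Cube n → ℚ
condE []          F x       = F x
condE (true  ∷ S) F (b ∷ x) = condE S (F ∘ (b ∷_)) x
condE (false ∷ S) F (b ∷ x) = condE S (avgHead F) x

condE-coeff : ∀ {n} (S : Subset n) (F : Cube n → ℚ) T → coeff (condE S F) T ≡ 𝟙 (T ⊆ᵇ S) * coeff F T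
condE-coeff []          F [] = sym (ℚ.*-identityˡ (coeff F []))
condE-coeff (true ∷ S)  F (true ∷ T) = begin
    coeff (condE (true ∷ S) F) (true ∷ T)
  ≡⟨ coeff-inside (condE (true ∷ S) F) T ⟩
    ½ * (coeff (condE S F₁) T - coeff (condE S F₀) T)
  ≡⟨ cong₂ (λ u v → ½ * (u - v)) (condE-coeff S F₁ T) (condE-coeff S F₀ T) ⟩
    ½ * (𝟙 (T ⊆ᵇ S) * coeff F₁ T - 𝟙 (T ⊆ᵇ S) * coeff F₀ T)
  ≡⟨ solve 3 (λ i a b → con ½ :* (i :* a :- i :* b) := i :* (con ½ :* (a :- b))) refl
       (𝟙 (T ⊆ᵇ S)) (coeff F₁ T) (coeff F₀ T) ⟩
    𝟙 (T ⊆ᵇ S) * (½ * (coeff F₁ T - coeff F₀ T))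
  ≡⟨ cong (𝟙 (T ⊆ᵇ S) *_) (sym (coeff-inside F T)) ⟩
    𝟙 (T ⊆ᵇ S) * coeff F (true ∷ T)
  ∎
  where open ≡-Reasoning
        F₁ = F ∘ (true ∷_)
        F₀ = F ∘ (false ∷_)
condE-coeff (true ∷ S)  F (false ∷ T) = begin
    coeff (condE (true ∷ S) F) (false ∷ T)
  ≡⟨ coeff-outside (condE (true ∷ S) F) T ⟩
    ½ * (coeff (condE S F₁) T + coeff (condE S F₀) T)
  ≡⟨ cong₂ (λ u v → ½ * (u + v)) (condE-coeff S F₁ T) (condE-coeff S F₀ T) ⟩
    ½ * (𝟙 (T ⊆ᵇ S) * coeff F₁ T + 𝟙 (T ⊆ᵇ S) * coeff F₀ T)
  ≡⟨ solve 3 (λ i a b → con ½ :* (i :* a :+ i :* b) := i :* (con ½ :* (a :+ b))) refl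
       (𝟙 (T ⊆ᵇ S)) (coeff F₁ T) (coeff F₀ T) ⟩
    𝟙 (T ⊆ᵇ S) * (½ * (coeff F₁ T + coeff F₀ T))
  ≡⟨ cong (𝟙 (T ⊆ᵇ S) *_) (sym (coeff-outside F T)) ⟩
    𝟙 (T ⊆ᵇ S) * coeff F (false ∷ T)
  ∎
  where open ≡-Reasoning
        F₁ = F ∘ (true ∷_)
        F₀ = F ∘ (false ∷_)
condE-coeff (false ∷ S) F (true ∷ T) = trans (coeff-inside (condE (false ∷ S) F) T)
  (solve 2 (λ m c → con ½ :* (m :- m) := con 0ℚ :* c) refl (coeff (condE S (avgHead F)) T) (coeff F (true ∷ T)))
condE-coeff (false ∷ S) F (false ∷ T) = begin
    coeff (condE (false ∷ S) F) (false ∷ T)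
  ≡⟨ coeff-outside (condE (false ∷ S) F) T ⟩
    ½ * (coeff (condE S (avgHead F)) T + coeff (condE S (avgHead F)) T)
  ≡⟨ solve 1 (λ m → con ½ :* (m :+ m) := m) refl (coeff (condE S (avgHead F)) T) ⟩
    coeff (condE S (avgHead F)) T
  ≡⟨ condE-coeff S (avgHead F) T ⟩
    𝟙 (T ⊆ᵇ S) * coeff (avgHead F) T
  ≡⟨ cong (𝟙 (T ⊆ᵇ S) *_) (coeff-avgHead F T) ⟩
    𝟙 (T ⊆ᵇ S) * coeff F (false ∷ T)
  ∎
  where open ≡-Reasoning

junta-tail : ∀ {n} {s} {S : Subset n} {F : Cube (suc n) → ℚ} → Junta (s ∷ S) F → ∀ b → Junta S (F ∘ (b ∷_))
junta-tail F-junta b x y x≈y = F-junta (b ∷ x) (b ∷ y) λ { zero _ → refl ; (suc i) → x≈y i }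

junta-avgHead : ∀ {n} {S : Subset n} {F : Cube (suc n) → ℚ} → Junta (false ∷ S) F → Junta S (avgHead F)
junta-avgHead F-junta x y x≈y =
  cong₂ (λ u v → ½ * (u + v)) (junta-tail F-junta true x y x≈y) (junta-tail F-junta false x y x≈y)

condE-junta : ∀ {n} (S : Subset n) F → Junta S (condE S F)
condE-junta []          F [] [] _ = refl
condE-junta (true  ∷ S) F (a ∷ x) (b ∷ y) x≈y rewrite x≈y zero refl = condE-junta S (F ∘ (b ∷_)) x y (x≈y ∘ suc)
condE-junta (false ∷ S) F (a ∷ x) (b ∷ y) x≈y = condE-junta S (avgHead F) x y (x≈y ∘ suc)

condE-id : ∀ {n} (S : Subset n) {F} → Junta S F → ∀ x → condE S F x ≡ F x
condE-id []          F-junta x       = refl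
condE-id (true  ∷ S) F-junta (b ∷ x) = condE-id S (junta-tail F-junta b) x
condE-id (false ∷ S) {F} F-junta (b ∷ x) = begin
    condE S (avgHead F) x
  ≡⟨ condE-id S (junta-avgHead F-junta) x ⟩
    ½ * (F (true ∷ x) + F (false ∷ x))
  ≡⟨ cong₂ (λ u v → ½ * (u + v)) (head-irrelevant true) (head-irrelevant false) ⟩
    ½ * (F (b ∷ x) + F (b ∷ x))
  ≡⟨ solve 1 (λ a → con ½ :* (a :+ a) := a) refl (F (b ∷ x)) ⟩
    F (b ∷ x)
  ∎
  where
  open ≡-Reasoning
  head-irrelevant : ∀ c → F (c ∷ x) ≡ F (b ∷ x)
  head-irrelevant c = F-junta (c ∷ x) (b ∷ x) λ { zero () ; (suc i) _ → refl }

infix 4 _∈[-1,1]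
_∈[-1,1] : ℚ → Set
p ∈[-1,1] = (- 1ℚ ℚ.≤ p) × (p ℚ.≤ 1ℚ)

sgn∈[-1,1] : ∀ b → sgn b ∈[-1,1]
sgn∈[-1,1] true  = ℚ.≤ᵇ⇒≤ _ , ℚ.≤-refl
sgn∈[-1,1] false = ℚ.≤-refl , ℚ.≤ᵇ⇒≤ _

average∈[-1,1] : ∀ {p q} → p ∈[-1,1] → q ∈[-1,1] → ½ * (p + q) ∈[-1,1]
average∈[-1,1] (-1≤p , p≤1) (-1≤q , q≤1) = ½*-mono (ℚ.+-mono-≤ -1≤p -1≤q) , ½*-mono (ℚ.+-mono-≤ p≤1 q≤1)
  where ½*-mono = ℚ.*-monoˡ-≤-nonNeg ½

condE∈[-1,1] : ∀ {n} (S : Subset n) {F} → (∀ x → F x ∈[-1,1]) → ∀ x → condE S F x ∈[-1,1]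
condE∈[-1,1] []          F∈ x       = F∈ x
condE∈[-1,1] (true  ∷ S) F∈ (b ∷ x) = condE∈[-1,1] S (F∈ ∘ (b ∷_)) x
condE∈[-1,1] (false ∷ S) F∈ (b ∷ x) = condE∈[-1,1] S (λ y → average∈[-1,1] (F∈ (true ∷ y)) (F∈ (false ∷ y))) x

junta-coeff : ∀ {n} (S : Subset n) {H} → Junta S H → ∀ T → coeff H T ≡ 𝟙 (T ⊆ᵇ S) * coeff H T
junta-coeff S {H} H-junta T = trans (sym (coeff-cong (condE-id S H-junta) T)) (condE-coeff S H T)

parseval-sgn : ∀ {n} (g : BoolFun n) → ∑ (allVecs n) (λ T → coeff (sgn ∘ g) T * coeff (sgn ∘ g) T) ≡ 1ℚ
parseval-sgn {n} g = trans (sym (plancherel n (sgn ∘ g) (sgn ∘ g))) (trans (E-cong (sgn-sq ∘ g)) (E-1 n))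

E-*-condE : ∀ {n} (S : Subset n) F {H} → Junta S H → E (λ x → F x * H x) ≡ E (λ x → condE S F x * H x)
E-*-condE {n} S F {H} H-junta = begin
    E (λ x → F x * H x)
  ≡⟨ plancherel n F H ⟩
    ∑ (allVecs n) (λ T → coeff F T * coeff H T)
  ≡⟨ ∑-cong (allVecs n) (λ T → begin
       coeff F T * coeff H T                  ≡⟨ cong (coeff F T *_) (junta-coeff S H-junta T) ⟩
       coeff F T * (𝟙 (T ⊆ᵇ S) * coeff H T)   ≡⟨ sym (ℚ.*-assoc (coeff F T) _ _) ⟩
       coeff F T * 𝟙 (T ⊆ᵇ S) * coeff H T     ≡⟨ cong (_* coeff H T) (ℚ.*-comm (coeff F T) _) ⟩
       𝟙 (T ⊆ᵇ S) * coeff F T * coeff H T     ≡⟨ cong (_* coeff H T) (sym (condE-coeff S F T)) ⟩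
       coeff (condE S F) T * coeff H T        ∎) ⟩
    ∑ (allVecs n) (λ T → coeff (condE S F) T * coeff H T)
  ≡⟨ sym (plancherel n (condE S F) H) ⟩
    E (λ x → condE S F x * H x)
  ∎
  where open ≡-Reasoning

-- Pointwise form of splitting ∑ F̂Ĝ, with Ĝ supported on subsets of P, into the sets
-- inside S and those inside P but not inside S.
split-product : ∀ s p a c → c ≡ 𝟙 p * c → a * c ≡ 𝟙 s * a * (𝟙 s * c) + 𝟙 (p ∧ not s) * a * c
split-product true  true  a c _ = solve 2 (λ a c → a :* c := con 1ℚ :* a :* (con 1ℚ :* c) :+ con 0ℚ :* a :* c) refl a c
split-product true  false a c _ = solve 2 (λ a c → a :* c := con 1ℚ :* a :* (con 1ℚ :* c) :+ con 0ℚ :* a :* c) refl a c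
split-product false true  a c _ = solve 2 (λ a c → a :* c := con 0ℚ :* a :* (con 0ℚ :* c) :+ con 1ℚ :* a :* c) refl a c
split-product false false a c c≡0*c = trans (cong (a *_) c≡0*c)
  (solve 2 (λ a c → a :* (con 0ℚ :* c) := con 0ℚ :* a :* (con 0ℚ :* c) :+ con 0ℚ :* a :* c) refl a c)

E-*-split : ∀ {n} (P S : Subset n) F {G} → Junta P G →
            E (λ x → F x * G x) ≡ E (λ x → condE S F x * condE S G x)
                                 + ∑ (allVecs n) (λ T → 𝟙 (T ⊆ᵇ P ∧ not (T ⊆ᵇ S)) * coeff F T * coeff G T)
E-*-split {n} P S F {G} G-junta = begin
    E (λ x → F x * G x)
  ≡⟨ plancherel n F G ⟩
    ∑ xs (λ T → coeff F T * coeff G T)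
  ≡⟨ ∑-cong xs (λ T → split-product (T ⊆ᵇ S) (T ⊆ᵇ P) (coeff F T) (coeff G T) (junta-coeff P G-junta T)) ⟩
    ∑ xs (λ T → 𝟙 (T ⊆ᵇ S) * coeff F T * (𝟙 (T ⊆ᵇ S) * coeff G T) + outside T)
  ≡⟨ ∑-+ xs _ outside ⟩
    ∑ xs (λ T → 𝟙 (T ⊆ᵇ S) * coeff F T * (𝟙 (T ⊆ᵇ S) * coeff G T)) + ∑ xs outside
  ≡⟨ cong (_+ ∑ xs outside) (∑-cong xs (λ T → sym (cong₂ _*_ (condE-coeff S F T) (condE-coeff S G T)))) ⟩
    ∑ xs (λ T → coeff (condE S F) T * coeff (condE S G) T) + ∑ xs outside
  ≡⟨ cong (_+ ∑ xs outside) (sym (plancherel n (condE S F) (condE S G))) ⟩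
    E (λ x → condE S F x * condE S G x) + ∑ xs outside
  ∎
  where
  open ≡-Reasoning
  xs = allVecs n
  outside : Subset n → ℚ
  outside T = 𝟙 (T ⊆ᵇ P ∧ not (T ⊆ᵇ S)) * coeff F T * coeff G T

sign : ℚ → Bool
sign a = does (0ℚ ℚ.≤? a)

*≤*sgn-sign : ∀ a {b} → b ∈[-1,1] → a * b ℚ.≤ a * sgn (sign a)
*≤*sgn-sign a {b} (-1≤b , b≤1) = by-cases (0ℚ ℚ.≤? a)
  where
  by-cases : (0≤a? : Dec (0ℚ ℚ.≤ a)) → a * b ℚ.≤ a * sgn (does 0≤a?)
  by-cases (yes 0≤a) = ℚ.*-monoˡ-≤-nonNeg a {{ℚ.nonNegative 0≤a}} b≤1
  by-cases (no  0≰a) = ℚ.*-monoˡ-≤-nonPos a {{ℚ.nonPositive (ℚ.<⇒≤ (ℚ.≰⇒> 0≰a))}} -1≤b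

E-*-≤-rounded : ∀ {n} (P S : Subset n) F {G} → Junta P G → (∀ x → G x ∈[-1,1]) →
                E (λ x → F x * G x) ℚ.≤ E (λ x → F x * sgn (sign (condE S F x)))
                                       + ∑ (allVecs n) (λ T → 𝟙 (T ⊆ᵇ P ∧ not (T ⊆ᵇ S)) * coeff F T * coeff G T)
E-*-≤-rounded P S F {G} G-junta G∈ = begin
    E (λ x → F x * G x)
  ≡⟨ E-*-split P S F G-junta ⟩
    E (λ x → condE S F x * condE S G x) + outside
  ≤⟨ ℚ.+-monoˡ-≤ outside (E-mono (λ x → *≤*sgn-sign (condE S F x) (condE∈[-1,1] S G∈ x))) ⟩
    E (λ x → condE S F x * sgn (sign (condE S F x))) + outside
  ≡⟨ cong (_+ outside) (sym (E-*-condE S F (λ x y x≈y → cong (sgn ∘ sign) (condE-junta S F x y x≈y)))) ⟩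
    E (λ x → F x * sgn (sign (condE S F x))) + outside
  ∎
  where
  open ℚ.≤-Reasoning
  outside = ∑ (allVecs _) (λ T → 𝟙 (T ⊆ᵇ P ∧ not (T ⊆ᵇ S)) * coeff F T * coeff G T)

-- Cauchy–Schwarz, via 2t·ab ≤ a² + t²b².
∑-*-≤ : ∀ {A : Set} (xs : List A) {a b : A → ℚ} {t} → 0ℚ < t →
        ∑ xs (λ x → a x * a x) ℚ.≤ t * t → ∑ xs (λ x → b x * b x) ℚ.≤ 1ℚ → ∑ xs (λ x → a x * b x) ℚ.≤ t
∑-*-≤ xs {a} {b} {t} 0<t ∑a²≤t² ∑b²≤1 = ℚ.*-cancelˡ-≤-pos (t + t) {{2t-pos}} (begin
    (t + t) * ∑ xs (λ x → a x * b x)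
  ≡⟨ sym (∑-* xs (t + t) _) ⟩
    ∑ xs (λ x → (t + t) * (a x * b x))
  ≤⟨ ∑-mono xs (λ x → am-gm (a x) (b x)) ⟩
    ∑ xs (λ x → a x * a x + t * t * (b x * b x))
  ≡⟨ trans (∑-+ xs _ _) (cong (_+_ (∑ xs (λ x → a x * a x))) (∑-* xs (t * t) _)) ⟩
    ∑ xs (λ x → a x * a x) + t * t * ∑ xs (λ x → b x * b x)
  ≤⟨ ℚ.+-mono-≤ ∑a²≤t² (ℚ.*-monoˡ-≤-nonNeg (t * t) {{ℚ.nonNegative (0≤p*p t)}} ∑b²≤1) ⟩
    t * t + t * t * 1ℚ
  ≡⟨ solve 1 (λ t → t :* t :+ t :* t :* con 1ℚ := (t :+ t) :* t) refl t ⟩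
    (t + t) * t
  ∎)
  where
  open ℚ.≤-Reasoning
  2t-pos : ℚ.Positive (t + t)
  2t-pos = ℚ.pos+pos⇒pos t {{ℚ.positive 0<t}} t {{ℚ.positive 0<t}}
  am-gm : ∀ p q → (t + t) * (p * q) ℚ.≤ p * p + t * t * (q * q)
  am-gm p q = 0≤q-p⇒p≤q (subst (0ℚ ℚ.≤_)
    (solve 3 (λ t p q → (p :- t :* q) :* (p :- t :* q) := (p :* p :+ t :* t :* (q :* q)) :- (t :+ t) :* (p :* q))
       refl t p q)
    (0≤p*p (p - t * q)))

initial : (n k : ℕ) → Subset n
initial zero    k       = []
initial (suc n) zero    = false ∷ initial n zero
initial (suc n) (suc k) = true ∷ initial n k

∈initial⇒< : ∀ {n k} (i : Fin n) → lookup (initial n k) i ≡ true → toℕ i ℕ.< k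
∈initial⇒< {suc n} {zero}  (suc i) i∈ with () ← ∈initial⇒< {n} {zero} i i∈
∈initial⇒< {suc n} {suc k} zero    _  = ℕ.s≤s ℕ.z≤n
∈initial⇒< {suc n} {suc k} (suc i) i∈ = ℕ.s≤s (∈initial⇒< i i∈)

<⇒∈initial : ∀ {n k} (i : Fin n) → toℕ i ℕ.< k → lookup (initial n k) i ≡ true
<⇒∈initial {suc n} {suc k} zero    _             = refl
<⇒∈initial {suc n} {suc k} (suc i) (ℕ.s≤s i<k) = <⇒∈initial i i<k

∣initial∣≤ : ∀ n k → ∣ initial n k ∣ ≤ k
∣initial∣≤ zero    k       = ℕ.z≤n
∣initial∣≤ (suc n) zero    = ∣initial∣≤ n zero
∣initial∣≤ (suc n) (suc k) = ℕ.s≤s (∣initial∣≤ n k)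

⊈-witness : ∀ {n} (T P S : Subset n) → T ⊆ᵇ P ∧ not (T ⊆ᵇ S) ≡ true →
            ∃ λ i → lookup T i ≡ true × lookup P i ≡ true × lookup S i ≡ false
⊈-witness []          []          []          ()
⊈-witness (true  ∷ T) (true  ∷ P) (false ∷ S) _ = zero , refl , refl , refl
⊈-witness (true  ∷ T) (true  ∷ P) (true  ∷ S) T⊈S = Product.map suc id (⊈-witness T P S T⊈S)
⊈-witness (false ∷ T) (_     ∷ P) (_     ∷ S) T⊈S = Product.map suc id (⊈-witness T P S T⊈S)

-- Every T ⊆ P with T ⊈ S contains a coordinate of P ∖ S, and has |T| ≤ k, so its
-- Fourier weight is counted in the low-degree influence of that coordinate.
weight-outside≤influence : ∀ {n} k (f : BoolFun n) (P S : Subset n) → ∣ P ∣ ≤ k →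
  ∑ (allVecs n) (λ T → 𝟙 (T ⊆ᵇ P ∧ not (T ⊆ᵇ S)) * (fourier f T * fourier f T))
    ℚ.≤ ∑ (allFin n) (λ i → 𝟙 (lookup P i ∧ not (lookup S i)) * Inf≤ k f i)
weight-outside≤influence {n} k f P S ∣P∣≤k = begin
    ∑ xs (λ T → 𝟙 (T ⊆ᵇ P ∧ not (T ⊆ᵇ S)) * w T)
  ≤⟨ ∑-mono xs term≤ ⟩
    ∑ xs (λ T → ∑ (allFin n) (λ i → c i * low i T))
  ≡⟨ ∑-comm xs (allFin n) (λ T i → c i * low i T) ⟩
    ∑ (allFin n) (λ i → ∑ xs (λ T → c i * low i T))
  ≡⟨ ∑-cong (allFin n) (λ i → trans (∑-* xs (c i) (low i))
       (cong (c i *_) (sym (∑-filter xs (λ T → lookup T i ∧ (∣ T ∣ ℕ.≤ᵇ k)) w)))) ⟩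
    ∑ (allFin n) (λ i → c i * Inf≤ k f i)
  ∎
  where
  open ℚ.≤-Reasoning
  xs = allVecs n
  w : Subset n → ℚ
  w T = fourier f T * fourier f T
  c : Fin n → ℚ
  c i = 𝟙 (lookup P i ∧ not (lookup S i))
  low : Fin n → Subset n → ℚ
  low i T = 𝟙 (lookup T i ∧ (∣ T ∣ ℕ.≤ᵇ k)) * w T
  0≤c*low : ∀ T i → 0ℚ ℚ.≤ c i * low i T
  0≤c*low T i = 0≤p*q (0≤𝟙 (lookup P i ∧ not (lookup S i)))
                      (0≤p*q (0≤𝟙 (lookup T i ∧ (∣ T ∣ ℕ.≤ᵇ k))) (0≤p*p (fourier f T)))
  term≤ : ∀ T → 𝟙 (T ⊆ᵇ P ∧ not (T ⊆ᵇ S)) * w T ℚ.≤ ∑ (allFin n) (λ i → c i * low i T)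
  term≤ T with T ⊆? P | T ⊆? S | ⊈-witness T P S
  ... | yes _ | yes _ | _ = ℚ.≤-trans (ℚ.≤-reflexive (ℚ.*-zeroˡ (w T))) (∑-nonneg (allFin n) (0≤c*low T))
  ... | no  _ | _     | _ = ℚ.≤-trans (ℚ.≤-reflexive (ℚ.*-zeroˡ (w T))) (∑-nonneg (allFin n) (0≤c*low T))
  ... | yes T⊆P | no _ | witness with witness refl
  ...   | i , Tᵢ , Pᵢ , Sᵢ = ℚ.≤-trans (ℚ.≤-reflexive w≡term) (term≤∑ (allFin n) (0≤c*low T) (∈-allFin i))
    where
    ∣T∣≤ᵇk : (∣ T ∣ ℕ.≤ᵇ k) ≡ true
    ∣T∣≤ᵇk = Equivalence.to T-≡ (ℕₚ.≤⇒≤ᵇ (ℕₚ.≤-trans (p⊆q⇒∣p∣≤∣q∣ T⊆P) ∣P∣≤k))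
    w≡term : 1ℚ * w T ≡ c i * low i T
    w≡term rewrite Tᵢ | Pᵢ | Sᵢ | ∣T∣≤ᵇk = cong (1ℚ *_) (sym (ℚ.*-identityˡ (w T)))

influential : ∀ {n} (k : ℕ) (f : BoolFun n) (τ : ℚ) → Subset n
influential {n} k f τ = tabulate (λ i → lookup (initial n k) i ∧ does (τ * τ ℚ.≤? toℚ (k ℕ.* k) * Inf≤ k f i))

weight-outside-influential≤τ² : ∀ {n} k (f : BoolFun n) τ →
  ∑ (allVecs n) (λ T → 𝟙 (T ⊆ᵇ initial n (suc k) ∧ not (T ⊆ᵇ influential (suc k) f τ))
                       * (fourier f T * fourier f T))
    ℚ.≤ τ * τ
weight-outside-influential≤τ² {n} k f τ = ℚ.*-cancelˡ-≤-pos k² {{toℚ-suc-pos (k ℕ.+ k ℕ.* suc k)}} (begin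
    k² * ∑ (allVecs n) (λ T → 𝟙 (T ⊆ᵇ P ∧ not (T ⊆ᵇ S)) * (fourier f T * fourier f T))
  ≤⟨ ℚ.*-monoˡ-≤-nonNeg k² {{ℚ.nonNegative (0≤toℚ (suc k ℕ.* suc k))}}
       (weight-outside≤influence (suc k) f P S (∣initial∣≤ n (suc k))) ⟩
    k² * ∑ (allFin n) (λ i → 𝟙 (lookup P i ∧ not (lookup S i)) * Inf≤ (suc k) f i)
  ≡⟨ sym (∑-* (allFin n) k² _) ⟩
    ∑ (allFin n) (λ i → k² * (𝟙 (lookup P i ∧ not (lookup S i)) * Inf≤ (suc k) f i))
  ≤⟨ ∑-mono (allFin n) uninfluential ⟩
    ∑ (allFin n) (λ i → τ * τ * 𝟙 (lookup P i))
  ≡⟨ trans (∑-* (allFin n) (τ * τ) _) (cong (τ * τ *_) (∑-𝟙-lookup P)) ⟩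
    τ * τ * toℚ ∣ P ∣
  ≤⟨ ℚ.*-monoˡ-≤-nonNeg (τ * τ) {{ℚ.nonNegative (0≤p*p τ)}}
       (toℚ-mono (ℕₚ.≤-trans (∣initial∣≤ n (suc k)) (ℕₚ.m≤m*n (suc k) (suc k)))) ⟩
    τ * τ * k²
  ≡⟨ ℚ.*-comm (τ * τ) k² ⟩
    k² * (τ * τ)
  ∎)
  where
  open ℚ.≤-Reasoning
  P = initial n (suc k)
  S = influential (suc k) f τ
  k² = toℚ (suc k ℕ.* suc k)
  by-cases : ∀ p I (τ²≤k²I? : Dec (τ * τ ℚ.≤ k² * I)) →
             k² * (𝟙 (p ∧ not (p ∧ does τ²≤k²I?)) * I) ℚ.≤ τ * τ * 𝟙 p
  by-cases false I _ = ℚ.≤-reflexive (solve 3 (λ k I t → k :* (con 0ℚ :* I) := t :* t :* con 0ℚ) refl k² I τ)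
  by-cases true I (yes _) = ℚ.≤-trans (ℚ.≤-reflexive (solve 2 (λ k I → k :* (con 0ℚ :* I) := con 0ℚ) refl k² I))
                                      (0≤p*q {τ * τ} (0≤p*p τ) (0≤𝟙 true))
  by-cases true I (no τ²≰k²I) = subst₂ ℚ._≤_ (cong (k² *_) (sym (ℚ.*-identityˡ I))) (sym (ℚ.*-identityʳ (τ * τ)))
                                       (ℚ.<⇒≤ (ℚ.≰⇒> τ²≰k²I))
  uninfluential : ∀ i → k² * (𝟙 (lookup P i ∧ not (lookup S i)) * Inf≤ (suc k) f i) ℚ.≤ τ * τ * 𝟙 (lookup P i)
  uninfluential i rewrite Vecₚ.lookup∘tabulate (λ i → lookup P i ∧ does (τ * τ ℚ.≤? k² * Inf≤ (suc k) f i)) i =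
    by-cases (lookup P i) (Inf≤ (suc k) f i) (τ * τ ℚ.≤? k² * Inf≤ (suc k) f i)

∧-does : ∀ {A : Set} p (a? : Dec A) → p ∧ does a? ≡ true → p ≡ true × A
∧-does true (yes a) _ = refl , a

∈influential : ∀ {n} k (f : BoolFun n) τ {i} → i ∈ influential k f τ →
               lookup (initial n k) i ≡ true × τ * τ ℚ.≤ toℚ (k ℕ.* k) * Inf≤ k f i
∈influential {n} k f τ {i} i∈S = ∧-does (lookup (initial n k) i) (τ * τ ℚ.≤? toℚ (k ℕ.* k) * Inf≤ k f i)
  (trans (sym (Vecₚ.lookup∘tabulate _ i)) (Vecₚ.[]=⇒lookup i∈S))

claim3p8 : (n k : ℕ) → k ≤ n → (f g : BoolFun n) → (c : ℚ)
    → DependsOnly (λ (i : Fin n) → toℕ i ℕ.< k) g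
    → c ℚ.≤ E (λ x → sgn (f x) * sgn (g x))
    → (τ : ℚ) → 0ℚ < τ
    → Σ (Subset n) (λ S →
        ((i : Fin n) → i ∈ S → toℕ i ℕ.< k)
        × ((i : Fin n) → i ∈ S → τ * τ ℚ.≤ ((+ (k ℕ.* k)) ℚ./ 1) * Inf≤ k f i)
        × Σ (BoolFun n) (λ h → DependsOnly (λ i → i ∈ S) h
            × c - τ ℚ.≤ E (λ x → sgn (f x) * sgn (h x))))
claim3p8 n zero _ f g c g-junta c≤E τ 0<τ =
  ⊥ , (λ _ i∈⊥ → ⊥-elim (∉⊥ i∈⊥)) , (λ _ i∈⊥ → ⊥-elim (∉⊥ i∈⊥)) ,
  g , (λ x y _ → g-junta x y (λ _ ())) , ≤+⇒-≤ (ℚ.≤-trans c≤E (p≤p+q _ (ℚ.<⇒≤ 0<τ)))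
claim3p8 n (suc k) _ f g c g-junta c≤E τ 0<τ =
  S , (λ i → ∈initial⇒< i ∘ proj₁ ∘ ∈influential (suc k) f τ) , (λ i → proj₂ ∘ ∈influential (suc k) f τ) ,
  h , h-junta , ≤+⇒-≤ (begin
    c                                               ≤⟨ c≤E ⟩
    E (λ x → F x * G x)                             ≤⟨ E-*-≤-rounded P S F G-junta (sgn∈[-1,1] ∘ g) ⟩
    E (λ x → F x * H x) + ∑ (allVecs n) outside     ≤⟨ ℚ.+-monoʳ-≤ (E (λ x → F x * H x)) outside≤τ ⟩
    E (λ x → F x * H x) + τ                         ∎)
  where
  open ℚ.≤-Reasoning
  P = initial n (suc k)
  S = influential (suc k) f τ
  F G H : Cube n → ℚ
  F = sgn ∘ f
  G = sgn ∘ g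
  h : BoolFun n
  h = sign ∘ condE S F
  H = sgn ∘ h
  h-junta : DependsOnly (_∈ S) h
  h-junta x y x≈y = cong sign (condE-junta S F x y (λ i Sᵢ → x≈y i (Vecₚ.lookup⇒[]= i S Sᵢ)))
  G-junta : Junta P G
  G-junta x y x≈y = cong sgn (g-junta x y (λ i i<k → x≈y i (<⇒∈initial i i<k)))
  outside : Subset n → ℚ
  outside T = 𝟙 (T ⊆ᵇ P ∧ not (T ⊆ᵇ S)) * coeff F T * coeff G T
  outside≤τ : ∑ (allVecs n) outside ℚ.≤ τ
  outside≤τ = ∑-*-≤ (allVecs n) {λ T → 𝟙 (T ⊆ᵇ P ∧ not (T ⊆ᵇ S)) * coeff F T} {coeff G} 0<τ
    (ℚ.≤-trans (ℚ.≤-reflexive (∑-cong (allVecs n) (λ T → 𝟙-idem (T ⊆ᵇ P ∧ not (T ⊆ᵇ S)) (coeff F T))))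
               (weight-outside-influential≤τ² k f τ))
    (ℚ.≤-reflexive (parseval-sgn g))
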